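{- For an integer $s\ge 4$ let $\sigma$ be the sequence $(1,2,2,3,4,5,7,8,8,10,10,12,12,\dots,2s,2s)$, consisting of $1,2,2,3,4,5,7$ followed by each even number $8,10,\dots,2s$ repeated twice. Then $\nu(\sigma)=0$, and, as a polynomial identity in $t$, $$\nu(\sigma+t)=-t\big(-12+(2s^2+2s-1)t+(2s+1)t^2\big).$$
   Context: For a finite sequence $(a_1,\dots,a_N)$ (repetitions allowed), $\nu(a_1,\dots,a_N)=\big(\sum a_i\big)^2-\sum a_i^3$, and $\sigma+t$ denotes the sequence $(a_1+t,\dots,a_N+t)$. -}

module Defs where

open import Data.Nat using (ℕ; zero; suc)
open import Data.Integer using (ℤ; +_; _+_; _*_; _-_)
open import Data.List using (List; []; _∷_; _++_; map; foldr)

sumℤ : List ℤ → ℤ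
sumℤ = foldr _+_ (+ 0)

ν : List ℤ → ℤ
ν as = sumℤ as * sumℤ as - sumℤ (map (λ a → a * a * a) as)

infixl 5 _⊕_
_⊕_ : List ℤ → ℤ → List ℤ
σ ⊕ t = map (λ a → a + t) σ

evens : ℕ → List ℤ
evens zero = []
evens (suc zero) = []
evens (suc (suc zero)) = []
evens (suc (suc (suc zero))) = []
evens (suc (suc (suc (suc k)))) =
  evens (suc (suc (suc k))) ++ (+ (2 Data.Nat.* (4 Data.Nat.+ k)) ∷ + (2 Data.Nat.* (4 Data.Nat.+ k)) ∷ [])

σseq : ℕ → List ℤ
σseq s = (+ 1 ∷ + 2 ∷ + 2 ∷ + 3 ∷ + 4 ∷ + 5 ∷ + 7 ∷ []) ++ evens s

{-# OPTIONS --safe #-}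
module Submission where

-- With pₖ the k-th power sum and n the length of σ, expanding (a + t)³ gives
--   ν(σ + t) = (p₁ + n t)² − (p₃ + 3 p₂ t + 3 p₁ t² + n t³),
-- so it suffices to know these power sums for σ_s. Adding the pair 2s, 2s to σ_{s-1}
-- makes them telescope to the closed forms n = 2s + 1, p₁ = 2s(s + 1),
-- 3p₂ = 4s(s + 1)(2s + 1) − 12 and p₃ = 4s²(s + 1)², all already valid for s = 3.
-- In particular p₁² = p₃, which is ν(σ_s) = 0, and substituting gives the polynomial.

open import Defs
open import Data.Nat using (ℕ; _≤_; suc; s≤s)
import Data.Nat as ℕ
open import Data.Integer using (ℤ; +_; -_; _+_; _*_; _-_)
open import Data.Integer.Properties using (+-identityˡ; +-assoc; *-zeroˡ; *-zeroʳ; *-distribˡ-+; pos-*)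
open import Data.Integer.Tactic.RingSolver using (solve-∀)
open import Data.List using (List; []; _∷_; _++_; map; length)
open import Data.List.Properties using (map-++; ++-assoc)
open import Data.Product using (_×_; _,_)
open import Function using (id)
open import Relation.Binary.PropositionalEquality
open ≡-Reasoning

square : ℤ → ℤ
square a = a * a

cube : ℤ → ℤ
cube a = a * a * a

sumOf : (ℤ → ℤ) → List ℤ → ℤ
sumOf f σ = sumℤ (map f σ)

sumℤ-++ : ∀ xs ys → sumℤ (xs ++ ys) ≡ sumℤ xs + sumℤ ys
sumℤ-++ []       ys = sym (+-identityˡ (sumℤ ys))
sumℤ-++ (x ∷ xs) ys = trans (cong (λ p → x + p) (sumℤ-++ xs ys)) (sym (+-assoc x (sumℤ xs) (sumℤ ys)))

sumOf-++ : ∀ f xs ys → sumOf f (xs ++ ys) ≡ sumOf f xs + sumOf f ys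
sumOf-++ f xs ys = trans (cong sumℤ (map-++ f xs ys)) (sumℤ-++ (map f xs) (map f ys))

sumOf-*ˡ : ∀ c f σ → c * sumOf f σ ≡ sumOf (λ a → c * f a) σ
sumOf-*ˡ c f []      = *-zeroʳ c
sumOf-*ˡ c f (a ∷ σ) = trans (*-distribˡ-+ c (f a) (sumOf f σ)) (cong (λ p → c * f a + p) (sumOf-*ˡ c f σ))

sumOf-id : ∀ σ → sumOf id σ ≡ sumℤ σ
sumOf-id []      = refl
sumOf-id (a ∷ σ) = cong (λ p → a + p) (sumOf-id σ)

sumOf-one : ∀ σ → sumOf (λ _ → + 1) σ ≡ + length σ
sumOf-one []      = refl
sumOf-one (a ∷ σ) = cong (λ p → + 1 + p) (sumOf-one σ)

sumℤ-⊕ : ∀ σ t → sumℤ (σ ⊕ t) ≡ sumℤ σ + + length σ * t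
sumℤ-⊕ []      t = sym (*-zeroˡ t)
sumℤ-⊕ (a ∷ σ) t = trans (cong (λ p → a + t + p) (sumℤ-⊕ σ t)) (step a (sumℤ σ) (+ length σ) t)
  where
  step : ∀ a p₁ n t → a + t + (p₁ + n * t) ≡ a + p₁ + (+ 1 + n) * t
  step = solve-∀

sumOf-cube-⊕ : ∀ σ t → sumOf cube (σ ⊕ t) ≡
  sumOf cube σ + t * (+ 3 * sumOf square σ) + + 3 * (t * t) * sumℤ σ + + length σ * (t * t * t)
sumOf-cube-⊕ []      = nil
  where
  nil : ∀ t → + 0 ≡ + 0 + t * (+ 3 * + 0) + + 3 * (t * t) * + 0 + + 0 * (t * t * t)
  nil = solve-∀
sumOf-cube-⊕ (a ∷ σ) t =
  trans (cong (λ p → cube (a + t) + p) (sumOf-cube-⊕ σ t))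
        (step a (sumℤ σ) (sumOf square σ) (sumOf cube σ) (+ length σ) t)
  where
  step : ∀ a p₁ p₂ p₃ n t →
    (a + t) * (a + t) * (a + t) + (p₃ + t * (+ 3 * p₂) + + 3 * (t * t) * p₁ + n * (t * t * t)) ≡
    a * a * a + p₃ + t * (+ 3 * (a * a + p₂)) + + 3 * (t * t) * (a + p₁) + (+ 1 + n) * (t * t * t)
  step = solve-∀

shiftedν : (n p₁ 3p₂ p₃ t : ℤ) → ℤ
shiftedν n p₁ 3p₂ p₃ t = (p₁ + n * t) * (p₁ + n * t) - (p₃ + t * 3p₂ + + 3 * (t * t) * p₁ + n * (t * t * t))

ν-⊕ : ∀ σ t → ν (σ ⊕ t) ≡
  shiftedν (+ length σ) (sumℤ σ) (+ 3 * sumOf square σ) (sumOf cube σ) t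
ν-⊕ σ t = cong₂ (λ p q → p * p - q) (sumℤ-⊕ σ t) (sumOf-cube-⊕ σ t)

σseq-suc : ∀ m → let y = + (2 ℕ.* (4 ℕ.+ m)) in σseq (4 ℕ.+ m) ≡ σseq (3 ℕ.+ m) ++ y ∷ y ∷ []
σseq-suc m = sym (++-assoc (+ 1 ∷ + 2 ∷ + 2 ∷ + 3 ∷ + 4 ∷ + 5 ∷ + 7 ∷ []) (evens (3 ℕ.+ m)) _)

sumOf-σseq : ∀ f (F : ℤ → ℤ) → sumOf f (σseq 3) ≡ F (+ 3) →
  (∀ s → F s + (f (+ 2 * (+ 1 + s)) + (f (+ 2 * (+ 1 + s)) + + 0)) ≡ F (+ 1 + s)) →
  ∀ m → sumOf f (σseq (3 ℕ.+ m)) ≡ F (+ (3 ℕ.+ m))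
sumOf-σseq f F base step ℕ.zero  = base
sumOf-σseq f F base step (suc m) = begin
  sumOf f (σseq (4 ℕ.+ m))                       ≡⟨ cong (sumOf f) (σseq-suc m) ⟩
  sumOf f (σseq (3 ℕ.+ m) ++ y ∷ y ∷ [])        ≡⟨ sumOf-++ f (σseq (3 ℕ.+ m)) (y ∷ y ∷ []) ⟩
  sumOf f (σseq (3 ℕ.+ m)) + (f y + (f y + + 0)) ≡⟨ cong₂ (λ p y → p + (f y + (f y + + 0)))
                                                          (sumOf-σseq f F base step m) (pos-* 2 (4 ℕ.+ m)) ⟩
  F s + (f (+ 2 * (+ 1 + s)) + (f (+ 2 * (+ 1 + s)) + + 0)) ≡⟨ step s ⟩
  F (+ 1 + s)                                    ∎
  where
  y = + (2 ℕ.* (4 ℕ.+ m))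
  s = + (3 ℕ.+ m)

module _ (m : ℕ) where
  private
    s : ℤ
    s = + (3 ℕ.+ m)

    σ : List ℤ
    σ = σseq (3 ℕ.+ m)

  length-σseq : + length σ ≡ + 2 * s + + 1
  length-σseq = trans (sym (sumOf-one σ)) (sumOf-σseq (λ _ → + 1) (λ s → + 2 * s + + 1) refl step m)
    where
    step : ∀ s → + 2 * s + + 1 + (+ 1 + (+ 1 + + 0)) ≡ + 2 * (+ 1 + s) + + 1
    step = solve-∀

  sumℤ-σseq : sumℤ σ ≡ + 2 * s * (s + + 1)
  sumℤ-σseq = trans (sym (sumOf-id σ)) (sumOf-σseq id (λ s → + 2 * s * (s + + 1)) refl step m)
    where
    step : ∀ s → + 2 * s * (s + + 1) + (+ 2 * (+ 1 + s) + (+ 2 * (+ 1 + s) + + 0)) ≡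
                 + 2 * (+ 1 + s) * (+ 1 + s + + 1)
    step = solve-∀

  sumOf-square-σseq : + 3 * sumOf square σ ≡ + 4 * s * (s + + 1) * (+ 2 * s + + 1) - + 12
  sumOf-square-σseq =
    trans (sumOf-*ˡ (+ 3) square σ)
          (sumOf-σseq (λ a → + 3 * square a) (λ s → + 4 * s * (s + + 1) * (+ 2 * s + + 1) - + 12) refl step m)
    where
    step : ∀ s → let y = + 2 * (+ 1 + s) in
      + 4 * s * (s + + 1) * (+ 2 * s + + 1) - + 12 + (+ 3 * (y * y) + (+ 3 * (y * y) + + 0)) ≡
      + 4 * (+ 1 + s) * (+ 1 + s + + 1) * (+ 2 * (+ 1 + s) + + 1) - + 12
    step = solve-∀

  sumOf-cube-σseq : sumOf cube σ ≡ + 4 * (s * s) * ((s + + 1) * (s + + 1))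
  sumOf-cube-σseq = sumOf-σseq cube (λ s → + 4 * (s * s) * ((s + + 1) * (s + + 1))) refl step m
    where
    step : ∀ s → let y = + 2 * (+ 1 + s) in
      + 4 * (s * s) * ((s + + 1) * (s + + 1)) + (y * y * y + (y * y * y + + 0)) ≡
      + 4 * ((+ 1 + s) * (+ 1 + s)) * ((+ 1 + s + + 1) * (+ 1 + s + + 1))
    step = solve-∀

  ν-σseq : ν σ ≡ + 0
  ν-σseq = begin
    sumℤ σ * sumℤ σ - sumOf cube σ
      ≡⟨ cong₂ (λ p q → p * p - q) sumℤ-σseq sumOf-cube-σseq ⟩
    + 2 * s * (s + + 1) * (+ 2 * s * (s + + 1)) - + 4 * (s * s) * ((s + + 1) * (s + + 1))
      ≡⟨ p₁²≡p₃ s ⟩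
    + 0 ∎
    where
    p₁²≡p₃ : ∀ s → + 2 * s * (s + + 1) * (+ 2 * s * (s + + 1)) - + 4 * (s * s) * ((s + + 1) * (s + + 1)) ≡ + 0
    p₁²≡p₃ = solve-∀

  ν-σseq-⊕ : ∀ t → ν (σ ⊕ t) ≡
    - (t * (- + 12 + (+ 2 * s * s + + 2 * s - + 1) * t + (+ 2 * s + + 1) * (t * t)))
  ν-σseq-⊕ t = begin
    ν (σ ⊕ t)
      ≡⟨ ν-⊕ σ t ⟩
    shiftedν (+ length σ) (sumℤ σ) (+ 3 * sumOf square σ) (sumOf cube σ) t
      ≡⟨ cong₂ (λ n p₁ → shiftedν n p₁ (+ 3 * sumOf square σ) (sumOf cube σ) t) length-σseq sumℤ-σseq ⟩
    shiftedν n p₁ (+ 3 * sumOf square σ) (sumOf cube σ) t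
      ≡⟨ cong₂ (λ 3p₂ p₃ → shiftedν n p₁ 3p₂ p₃ t) sumOf-square-σseq sumOf-cube-σseq ⟩
    shiftedν n p₁ 3p₂ p₃ t
      ≡⟨ substituted s t ⟩
    - (t * (- + 12 + (+ 2 * s * s + + 2 * s - + 1) * t + (+ 2 * s + + 1) * (t * t))) ∎
    where
    n p₁ 3p₂ p₃ : ℤ
    n   = + 2 * s + + 1
    p₁  = + 2 * s * (s + + 1)
    3p₂ = + 4 * s * (s + + 1) * (+ 2 * s + + 1) - + 12
    p₃  = + 4 * (s * s) * ((s + + 1) * (s + + 1))

    -- shiftedν unfolded, since solve-∀ does not look inside definitions
    substituted : ∀ s t →
      let n   = + 2 * s + + 1
          p₁  = + 2 * s * (s + + 1)
          3p₂ = + 4 * s * (s + + 1) * (+ 2 * s + + 1) - + 12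
          p₃  = + 4 * (s * s) * ((s + + 1) * (s + + 1))
      in (p₁ + n * t) * (p₁ + n * t) - (p₃ + t * 3p₂ + + 3 * (t * t) * p₁ + n * (t * t * t)) ≡
         - (t * (- + 12 + (+ 2 * s * s + + 2 * s - + 1) * t + (+ 2 * s + + 1) * (t * t)))
    substituted = solve-∀

mainTheorem6 : (s : ℕ) → 4 ≤ s →
    (ν (σseq s) ≡ + 0) ×
    ((t : ℤ) → ν (σseq s ⊕ t) ≡
      - (t * (- + 12 + (+ 2 * + s * + s + + 2 * + s - + 1) * t + (+ 2 * + s + + 1) * (t * t))))
mainTheorem6 (suc (suc (suc m))) (s≤s (s≤s (s≤s _))) = ν-σseq m , ν-σseq-⊕ m
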